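{- Fix an integer $t\geq 2$ and let $A_t$ be the matrix defined in the context, with $n=|\mathcal{I}|=k^{t^2k}$. Then $\|A_t\|_1=\Theta\big(n(\log n/\log\log n)^t\big)$ as $k\to\infty$.
   Context: Let $[k]=\{1,\dots,k\}$, $t\ge 2$ a fixed integer and $k$ a positive integer. Let $\mathcal{I}=[k^t]^{tk}$; an element $a\in\mathcal{I}$ is viewed as $t$ consecutive blocks of length $k$, and $a(p,q)\in[k^t]$ denotes the $q$-th coordinate of the $p$-th block ($p\in[t]$, $q\in[k]$). $\mathcal{I}$ is ordered lexicographically (coordinates ordered block by block, and within a block by $q$). For $r\ge 0$ and $(j_1,\dots,j_r)\in[k]^r$ let $\langle j_1,\dots,j_r\rangle=1+\sum_{s=1}^r (j_s-1)k^{r-s}\in[k^r]$ (an injective map; in particular $\langle\ \rangle=1$ for $r=0$). For $(j_1,\dots,j_t)\in[k]^t$ let $\mathbf{v}[j_1,\dots,j_t]\in\mathbb{Z}^{tk}$ be the integer vector (indexed like elements of $\mathcal{I}$) which is $0$ in every coordinate except that its coordinate $(r,j_r)$ equals $\langle j_1,\dots,j_{r-1}\rangle$ for each $r\in[t]$. Let $\mathcal{S}=\{\mathbf{v}[j_1,\dots,j_t]:(j_1,\dots,j_t)\in[k]^t\}$. $A_t$ is the $n\times n$ 0--1 matrix with rows and columns indexed by $\mathcal{I}$ in lexicographic order, with $A_t(a,b)=1$ iff $b-a\in\mathcal{S}$ (coordinatewise difference), and $0$ otherwise. $\|A_t\|_1$ is the number of 1s of $A_t$. -}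

module Defs where

open import Data.Nat using (ℕ; zero; suc; _+_; _*_; _∸_; _^_; _≡ᵇ_)
open import Data.Bool using (Bool; true; false; if_then_else_)
open import Data.List using (List; []; _∷_; [_]; map; concatMap; upTo; zipWith; _++_; foldl)
open import Data.Nat.ListAction using (sum)
open import Data.Bool.ListAction using (any)
open import Data.List.Properties using (≡-dec)
open import Data.Integer as ℤ using (ℤ; +_; _-_)
open import Relation.Nullary using (does)

range : ℕ → List ℕ
range k = map suc (upTo k)

tuples : ℕ → List ℕ → List (List ℕ)
tuples zero    xs = [ [] ]
tuples (suc m) xs = concatMap (λ x → map (x ∷_) (tuples m xs)) xs

-- 𝓘 = [k^t]^{tk}; an element is a flat list of length t*k, coordinate (p,q)
-- (p ∈ [t], q ∈ [k]) sits at position (p-1)k + (q-1).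
𝓘 : ℕ → ℕ → List (List ℕ)
𝓘 t k = tuples (t * k) (range (k ^ t))

-- ⟨ j₁,…,j_r ⟩ = 1 + Σ_s (j_s - 1) k^{r-s}
angle : ℕ → List ℕ → ℕ
angle k js = 1 + foldl (λ acc j → acc * k + (j ∸ 1)) 0 js

block : ℕ → ℕ → ℕ → List ℕ
block k j val = map (λ q → if q ≡ᵇ j then val else 0) (range k)

-- v[j₁,…,j_t]: block r has value ⟨j₁,…,j_{r-1}⟩ at coordinate j_r
vAux : ℕ → List ℕ → List ℕ → List ℕ
vAux k prefix []       = []
vAux k prefix (j ∷ js) = block k j (angle k prefix) ++ vAux k (prefix ++ [ j ]) js

v : ℕ → List ℕ → List ℕ
v k js = vAux k [] js

𝓢 : ℕ → ℕ → List (List ℕ)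
𝓢 t k = map (v k) (tuples t (range k))

diff : List ℕ → List ℕ → List ℤ
diff b a = zipWith (λ x y → + x - + y) b a

inS : ℕ → ℕ → List ℤ → Bool
inS t k d = any (λ s → does (≡-dec ℤ._≟_ (map +_ s) d)) (𝓢 t k)

A : ℕ → ℕ → List ℕ → List ℕ → ℕ
A t k a b = if inS t k (diff b a) then 1 else 0

norm1 : ℕ → ℕ → ℕ
norm1 t k = sum (map (λ a → sum (map (λ b → A t k a b) (𝓘 t k))) (𝓘 t k))

size : ℕ → ℕ → ℕ
size t k = (k ^ t) ^ (t * k)

module Submission where

-- Every 1 of A_t is a pair (a, b) with b - a = v[j] for exactly one j, because j ↦ v[j] is
-- injective. Hence ‖A_t‖₁ = ∑_j ∏_i #{(x, y) ∈ [N]² : y - x = v[j]ᵢ} with N = k^t, and each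
-- factor lies between N - v[j]ᵢ and N. The entries of v[j] sum to at most t k^(t-1) ≤ N/2 once
-- k ≥ 2t, so by Weierstrass' product inequality every product lies between n/2 and n, and
-- k^t n/2 ≤ ‖A_t‖₁ ≤ k^t n. Finally log n = Θ(t² k log k) and log log n = Θ(log k), so
-- k^t = Θ((log n / log log n)^t).

open import Defs
open import Data.Product using (Σ; _×_; _,_; proj₁; proj₂; ∃-syntax)
open import Data.Bool using (Bool; true; false; if_then_else_; _∧_)
open import Data.Bool.ListAction using (any)
open import Data.Integer as ℤ using (ℤ)
import Data.Integer.Properties as ℤ
open import Algebra.Properties.AbelianGroup ℤ.+-0-abelianGroup using (//-rightDividesˡ; //-rightDividesʳ)
open import Data.List
  using (List; []; _∷_; [_]; map; _++_; length; concatMap; cartesianProductWith; applyUpTo; upTo; foldl)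
open import Data.List.Membership.Propositional using (_∈_)
open import Data.List.Membership.Propositional.Properties
  using (∈-map⁺; ∈-map⁻; ∈-upTo⁺; ∈-upTo⁻; ∈-cartesianProductWith⁻)
open import Data.List.Properties
  using (map-∘; map-++; ≡-dec; ∷-injective; ∷-injectiveˡ; ∷-injectiveʳ; length-map; length-++; length-upTo; map-injective)
open import Data.List.Relation.Unary.All as All using (All)
import Data.List.Relation.Unary.All.Properties as All
import Data.List.Relation.Unary.AllPairs as AllPairs
open import Data.List.Relation.Unary.Any using (here; there)
open import Data.List.Relation.Unary.Unique.Propositional using (Unique)
import Data.List.Relation.Unary.Unique.Propositional.Properties as Unique
open import Data.Nat
open import Data.Nat.ListAction using (sum; product)
open import Data.Nat.ListAction.Properties using (sum-++)
open import Data.Nat.Logarithm using (⌊log₂_⌋; ⌊log₂⌋-mono-≤; ⌊log₂[2^n]⌋≡n)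
open import Data.Nat.Properties
open import Data.Nat.Tactic.RingSolver using (solve; solve-∀)
open import Algebra.Properties.CommutativeSemigroup +-commutativeSemigroup
  using () renaming (interchange to +-interchange)
open import Algebra.Properties.CommutativeSemigroup *-commutativeSemigroup
  using () renaming (interchange to *-interchange)
open import Function using (id; _∘_; _⇔_; mk⇔)
open import Relation.Binary.Definitions using (DecidableEquality)
open import Relation.Binary.PropositionalEquality hiding ([_]; J)
open import Relation.Nullary using (Dec; yes; no; does; contradiction)
open import Relation.Nullary.Decidable using (does-⇔; dec-true; dec-false)

private
  variable
    X Y Z : Set

∑ : List X → (X → ℕ) → ℕ
∑ xs f = sum (map f xs)

infixr 8 ∑
syntax ∑ xs (λ x → e) = ∑[ x ∈ xs ] e

∑-cong : ∀ (xs : List X) {f g : X → ℕ} → (∀ {x} → x ∈ xs → f x ≡ g x) → ∑ xs f ≡ ∑ xs g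
∑-cong []       eq = refl
∑-cong (x ∷ xs) eq = cong₂ _+_ (eq (here refl)) (∑-cong xs (eq ∘ there))

∑-mono-≤ : ∀ (xs : List X) {f g : X → ℕ} → (∀ {x} → x ∈ xs → f x ≤ g x) → ∑ xs f ≤ ∑ xs g
∑-mono-≤ []       le = z≤n
∑-mono-≤ (x ∷ xs) le = +-mono-≤ (le (here refl)) (∑-mono-≤ xs (le ∘ there))

∑-const : ∀ (xs : List X) c → ∑[ x ∈ xs ] c ≡ length xs * c
∑-const []       c = refl
∑-const (x ∷ xs) c = cong (c +_) (∑-const xs c)

∑-distrib-+ : ∀ (xs : List X) f g → ∑[ x ∈ xs ] (f x + g x) ≡ ∑ xs f + ∑ xs g
∑-distrib-+ []       f g = refl
∑-distrib-+ (x ∷ xs) f g =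
  trans (cong (f x + g x +_) (∑-distrib-+ xs f g)) (+-interchange (f x) (g x) (∑ xs f) (∑ xs g))

∑-*ˡ : ∀ (xs : List X) c f → ∑[ x ∈ xs ] (c * f x) ≡ c * ∑ xs f
∑-*ˡ []       c f = sym (*-zeroʳ c)
∑-*ˡ (x ∷ xs) c f = trans (cong (c * f x +_) (∑-*ˡ xs c f)) (sym (*-distribˡ-+ c (f x) _))

∑-*ʳ : ∀ (xs : List X) c f → ∑[ x ∈ xs ] (f x * c) ≡ ∑ xs f * c
∑-*ʳ xs c f = trans (∑-cong xs (λ _ → *-comm (f _) c)) (trans (∑-*ˡ xs c f) (*-comm c _))

∑-++ : ∀ (xs ys : List X) f → ∑ (xs ++ ys) f ≡ ∑ xs f + ∑ ys f
∑-++ xs ys f = trans (cong sum (map-++ f xs ys)) (sum-++ (map f xs) (map f ys))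

∑-map : ∀ (h : Y → X) (xs : List Y) f → ∑ (map h xs) f ≡ ∑[ x ∈ xs ] f (h x)
∑-map h xs f = cong sum (sym (map-∘ xs))

∑-comm : ∀ (xs : List X) (ys : List Y) (f : X → Y → ℕ) →
         ∑[ x ∈ xs ] ∑[ y ∈ ys ] f x y ≡ ∑[ y ∈ ys ] ∑[ x ∈ xs ] f x y
∑-comm []       ys f = sym (trans (∑-const ys 0) (*-zeroʳ (length ys)))
∑-comm (x ∷ xs) ys f =
  trans (cong (∑ ys (f x) +_) (∑-comm xs ys f)) (sym (∑-distrib-+ ys (f x) _))

∑-cartesianProductWith : ∀ (_·_ : X → Y → Z) xs ys (f : Z → ℕ) →
  ∑ (cartesianProductWith _·_ xs ys) f ≡ ∑[ x ∈ xs ] ∑[ y ∈ ys ] f (x · y)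
∑-cartesianProductWith _·_ []       ys f = refl
∑-cartesianProductWith _·_ (x ∷ xs) ys f = begin
  ∑ (map (x ·_) ys ++ cartesianProductWith _·_ xs ys) f
    ≡⟨ ∑-++ (map (x ·_) ys) _ f ⟩
  ∑ (map (x ·_) ys) f + ∑ (cartesianProductWith _·_ xs ys) f
    ≡⟨ cong₂ _+_ (∑-map (x ·_) ys f) (∑-cartesianProductWith _·_ xs ys f) ⟩
  ∑[ y ∈ ys ] f (x · y) + ∑[ x ∈ xs ] ∑[ y ∈ ys ] f (x · y) ∎
  where open ≡-Reasoning

⟦_⟧ : Bool → ℕ
⟦ b ⟧ = if b then 1 else 0

𝟙 : {P : Set} → Dec P → ℕ
𝟙 p = ⟦ does p ⟧

⟦∧⟧ : ∀ b c → ⟦ b ∧ c ⟧ ≡ ⟦ b ⟧ * ⟦ c ⟧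
⟦∧⟧ false c = refl
⟦∧⟧ true  c = sym (+-identityʳ ⟦ c ⟧)

⟦any⟧ : ∀ (p : X → Bool) xs → ∑[ x ∈ xs ] ⟦ p x ⟧ ≤ 1 → ⟦ any p xs ⟧ ≡ ∑[ x ∈ xs ] ⟦ p x ⟧
⟦any⟧ p []       _  = refl
⟦any⟧ p (x ∷ xs) ≤1 with p x
... | true  = cong suc (sym (n≤0⇒n≡0 (s≤s⁻¹ ≤1)))
... | false = ⟦any⟧ p xs ≤1

module _ (_≟_ : DecidableEquality X) where

  ∑-𝟙≟-absent : ∀ {xs y} → All (y ≢_) xs → ∑[ x ∈ xs ] 𝟙 (x ≟ y) ≡ 0
  ∑-𝟙≟-absent All.[] = refl
  ∑-𝟙≟-absent {x ∷ xs} {y} (y≢x All.∷ y∉xs) with x ≟ y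
  ... | yes x≡y = contradiction (sym x≡y) y≢x
  ... | no  _   = ∑-𝟙≟-absent y∉xs

  ∑-𝟙≟-unique : ∀ {xs} → Unique xs → ∀ y → ∑[ x ∈ xs ] 𝟙 (x ≟ y) ≤ 1
  ∑-𝟙≟-unique AllPairs.[] y = z≤n
  ∑-𝟙≟-unique {x ∷ xs} (x∉xs AllPairs.∷ xs!) y with x ≟ y
  ... | yes refl = ≤-reflexive (cong suc (∑-𝟙≟-absent x∉xs))
  ... | no  _    = ∑-𝟙≟-unique xs! y

  ∑-𝟙≟-member : ∀ {xs y} → y ∈ xs → 1 ≤ ∑[ x ∈ xs ] 𝟙 (x ≟ y)
  ∑-𝟙≟-member {x ∷ xs} {y} y∈ with x ≟ y | y∈
  ... | yes _   | _          = s≤s z≤n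
  ... | no  x≢y | here y≡x   = contradiction (sym y≡x) x≢y
  ... | no  _   | there y∈xs = ∑-𝟙≟-member y∈xs

Unique-map⁺ : ∀ {f : X → Y} {xs} → (∀ {x y} → x ∈ xs → y ∈ xs → f x ≡ f y → x ≡ y) →
              Unique xs → Unique (map f xs)
Unique-map⁺ inj AllPairs.[]            = AllPairs.[]
Unique-map⁺ inj (x∉xs AllPairs.∷ xs!) =
  All.map⁺ (All.tabulate λ y∈xs fx≡fy → All.lookup x∉xs y∈xs (inj (here refl) (there y∈xs) fx≡fy))
  AllPairs.∷ Unique-map⁺ (λ x∈ y∈ → inj (there x∈) (there y∈)) xs!

++-injective : ∀ (xs ys : List X) {us vs} → length xs ≡ length ys → xs ++ us ≡ ys ++ vs →
               xs ≡ ys × us ≡ vs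
++-injective []       []       _     eq = refl , eq
++-injective (x ∷ xs) (y ∷ ys) |x∷xs| eq =
  let xs≡ys , us≡vs = ++-injective xs ys (suc-injective |x∷xs|) (∷-injectiveʳ eq)
  in cong₂ _∷_ (∷-injectiveˡ eq) xs≡ys , us≡vs

map-≡⇒≡ : ∀ {f g : X → Y} {xs x} → map f xs ≡ map g xs → x ∈ xs → f x ≡ g x
map-≡⇒≡ eq (here refl)  = ∷-injectiveˡ eq
map-≡⇒≡ eq (there x∈xs) = map-≡⇒≡ (∷-injectiveʳ eq) x∈xs

length-cartesianProductWith : ∀ (f : X → Y → Z) xs ys →
  length (cartesianProductWith f xs ys) ≡ length xs * length ys
length-cartesianProductWith f []       ys = refl
length-cartesianProductWith f (x ∷ xs) ys =
  trans (length-++ (map (f x) ys)) (cong₂ _+_ (length-map (f x) ys) (length-cartesianProductWith f xs ys))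

concatMap-map : ∀ (f : X → Y → Z) xs ys →
  concatMap (λ x → map (f x) ys) xs ≡ cartesianProductWith f xs ys
concatMap-map f []       ys = refl
concatMap-map f (x ∷ xs) ys = cong (map (f x) ys ++_) (concatMap-map f xs ys)

tuples-suc : ∀ m xs → tuples (suc m) xs ≡ cartesianProductWith _∷_ xs (tuples m xs)
tuples-suc m xs = concatMap-map _∷_ xs (tuples m xs)

∑-tuples-suc : ∀ m xs (f : List ℕ → ℕ) →
  ∑ (tuples (suc m) xs) f ≡ ∑[ x ∈ xs ] ∑[ ys ∈ tuples m xs ] f (x ∷ ys)
∑-tuples-suc m xs f =
  trans (cong (λ T → ∑ T f) (tuples-suc m xs)) (∑-cartesianProductWith _∷_ xs (tuples m xs) f)

length-tuples : ∀ m xs → length (tuples m xs) ≡ length xs ^ m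
length-tuples zero    xs = refl
length-tuples (suc m) xs = begin
  length (tuples (suc m) xs)                             ≡⟨ cong length (tuples-suc m xs) ⟩
  length (cartesianProductWith _∷_ xs (tuples m xs))   ≡⟨ length-cartesianProductWith _∷_ xs _ ⟩
  length xs * length (tuples m xs)                       ≡⟨ cong (length xs *_) (length-tuples m xs) ⟩
  length xs * length xs ^ m                              ∎
  where open ≡-Reasoning

∈-tuples⁻ : ∀ m xs {ys} → ys ∈ tuples m xs → length ys ≡ m × All (_∈ xs) ys
∈-tuples⁻ zero    xs (here refl) = refl , All.[]
∈-tuples⁻ (suc m) xs ys∈ rewrite tuples-suc m xs
  with _ , _ , x∈xs , ys′∈ , refl ← ∈-cartesianProductWith⁻ _∷_ xs (tuples m xs) ys∈ =
  let |ys′| , ys′⊆xs = ∈-tuples⁻ m xs ys′∈ in cong suc |ys′| , x∈xs All.∷ ys′⊆xs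

Unique-tuples : ∀ m {xs} → Unique xs → Unique (tuples m xs)
Unique-tuples zero    xs! = All.[] AllPairs.∷ AllPairs.[]
Unique-tuples (suc m) {xs} xs! = subst Unique (sym (tuples-suc m xs))
  (Unique.cartesianProductWith⁺ _∷_ ∷-injective xs! (Unique-tuples m xs!))

∑-applyUpTo-≥ : ∀ (f : ℕ → X) (g : X → ℕ) {M N} → M ≤ N → (∀ {i} → i < M → 1 ≤ g (f i)) →
                M ≤ ∑[ x ∈ applyUpTo f N ] g x
∑-applyUpTo-≥ f g z≤n       _   = z≤n
∑-applyUpTo-≥ f g (s≤s M≤N) pos = +-mono-≤ (pos z<s) (∑-applyUpTo-≥ (f ∘ suc) g M≤N (pos ∘ s<s))

∑-range-≥ : ∀ (g : ℕ → ℕ) {M N} → M ≤ N → (∀ {i} → i < M → 1 ≤ g (suc i)) →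
            M ≤ ∑[ x ∈ range N ] g x
∑-range-≥ g {N = N} M≤N pos =
  subst (_ ≤_) (sym (∑-map suc (upTo N) g)) (∑-applyUpTo-≥ id (g ∘ suc) M≤N pos)

∈-range⁺ : ∀ {N i} → i < N → suc i ∈ range N
∈-range⁺ i<N = ∈-map⁺ suc (∈-upTo⁺ i<N)

∈-range⁻ : ∀ {N x} → x ∈ range N → 1 ≤ x × x ≤ N
∈-range⁻ x∈ with _ , i∈ , refl ← ∈-map⁻ suc x∈ = s≤s z≤n , ∈-upTo⁻ i∈

length-range : ∀ N → length (range N) ≡ N
length-range N = trans (length-map suc (upTo N)) (length-upTo N)

Unique-range : ∀ N → Unique (range N)
Unique-range N = Unique.map⁺ suc-injective (Unique.upTo⁺ N)

-- Pairs with prescribed differences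

+u≡+y-+x⇔y≡u+x : ∀ u x y → (ℤ.+ u ≡ ℤ.+ y ℤ.- ℤ.+ x) ⇔ (y ≡ u + x)
+u≡+y-+x⇔y≡u+x u x y = mk⇔
  (λ eq → ℤ.+-injective (sym (trans (cong (ℤ._+ ℤ.+ x) eq) (//-rightDividesˡ (ℤ.+ x) (ℤ.+ y)))))
  (λ { refl → sym (//-rightDividesʳ (ℤ.+ x) (ℤ.+ u)) })

differenceCount : List ℕ → ℕ → ℕ
differenceCount xs u = ∑[ x ∈ xs ] ∑[ y ∈ xs ] 𝟙 (ℤ.+ u ℤ.≟ ℤ.+ y ℤ.- ℤ.+ x)

∑-𝟙[u≟y-x]≡∑-𝟙[y≟u+x] : ∀ N u x →
  ∑[ y ∈ range N ] 𝟙 (ℤ.+ u ℤ.≟ ℤ.+ y ℤ.- ℤ.+ x) ≡ ∑[ y ∈ range N ] 𝟙 (y ≟ u + x)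
∑-𝟙[u≟y-x]≡∑-𝟙[y≟u+x] N u x = ∑-cong (range N) λ {y} _ →
  cong ⟦_⟧ (does-⇔ (+u≡+y-+x⇔y≡u+x u x y) (ℤ.+ u ℤ.≟ ℤ.+ y ℤ.- ℤ.+ x) (y ≟ u + x))

differenceCount≤ : ∀ N u → differenceCount (range N) u ≤ N
differenceCount≤ N u = begin
  differenceCount (range N) u
    ≤⟨ ∑-mono-≤ (range N) (λ {x} _ → ≤-trans (≤-reflexive (∑-𝟙[u≟y-x]≡∑-𝟙[y≟u+x] N u x))
                                              (∑-𝟙≟-unique _≟_ (Unique-range N) (u + x))) ⟩
  ∑[ x ∈ range N ] 1 ≡⟨ ∑-const (range N) 1 ⟩
  length (range N) * 1 ≡⟨ trans (*-identityʳ _) (length-range N) ⟩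
  N ∎
  where open ≤-Reasoning

∸≤differenceCount : ∀ N u → N ∸ u ≤ differenceCount (range N) u
∸≤differenceCount N u with u ≤? N
... | no  u≰N = subst (_≤ differenceCount (range N) u) (sym (m≤n⇒m∸n≡0 (<⇒≤ (≰⇒> u≰N)))) z≤n
... | yes u≤N = ∑-range-≥ _ (m∸n≤m N u) λ {i} i<N∸u →
  subst (1 ≤_) (sym (∑-𝟙[u≟y-x]≡∑-𝟙[y≟u+x] N u (suc i)))
    (∑-𝟙≟-member _≟_ (subst (_∈ range N) (sym (+-suc u i)) (∈-range⁺ (u+i<N i<N∸u))))
  where
  u+i<N : ∀ {i} → i < N ∸ u → u + i < N
  u+i<N {i} i<N∸u = subst (_≤ N) (+-suc u i) (subst (u + suc i ≤_) (m+[n∸m]≡n u≤N) (+-monoʳ-≤ u i<N∸u))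

∑-*-∑ : ∀ (xs : List X) (as : List Y) (f : X → X → ℕ) (g : Y → Y → ℕ) →
  ∑[ x ∈ xs ] ∑[ a ∈ as ] ∑[ y ∈ xs ] ∑[ b ∈ as ] (f x y * g a b)
    ≡ (∑[ x ∈ xs ] ∑[ y ∈ xs ] f x y) * (∑[ a ∈ as ] ∑[ b ∈ as ] g a b)
∑-*-∑ xs as f g = begin
  ∑[ x ∈ xs ] ∑[ a ∈ as ] ∑[ y ∈ xs ] ∑[ b ∈ as ] (f x y * g a b)
    ≡⟨ ∑-cong xs (λ {x} _ → ∑-cong as λ {a} _ → ∑-cong xs λ {y} _ → ∑-*ˡ as (f x y) (g a)) ⟩
  ∑[ x ∈ xs ] ∑[ a ∈ as ] ∑[ y ∈ xs ] (f x y * G a)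
    ≡⟨ ∑-cong xs (λ {x} _ → ∑-cong as λ {a} _ → ∑-*ʳ xs (G a) (f x)) ⟩
  ∑[ x ∈ xs ] ∑[ a ∈ as ] (F x * G a)
    ≡⟨ ∑-cong xs (λ {x} _ → ∑-*ˡ as (F x) G) ⟩
  ∑[ x ∈ xs ] (F x * ∑ as G)
    ≡⟨ ∑-*ʳ xs (∑ as G) F ⟩
  ∑ xs F * ∑ as G ∎
  where
  open ≡-Reasoning
  F = λ x → ∑[ y ∈ xs ] f x y
  G = λ a → ∑[ b ∈ as ] g a b

pairCount : List ℕ → ℕ → List ℕ → ℕ
pairCount xs m s = ∑[ a ∈ tuples m xs ] ∑[ b ∈ tuples m xs ] 𝟙 (≡-dec ℤ._≟_ (map ℤ.+_ s) (diff b a))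

pairCount≡product : ∀ xs s → pairCount xs (length s) s ≡ product (map (differenceCount xs) s)
pairCount≡product xs []      = refl
pairCount≡product xs (u ∷ s) = begin
  pairCount xs (suc m) (u ∷ s)
    ≡⟨ ∑-tuples-suc m xs _ ⟩
  ∑[ x ∈ xs ] ∑[ a ∈ T ] ∑[ b ∈ tuples (suc m) xs ] E (u ∷ s) (x ∷ a) b
    ≡⟨ ∑-cong xs (λ {x} _ → ∑-cong T λ {a} _ → ∑-tuples-suc m xs (E (u ∷ s) (x ∷ a))) ⟩
  ∑[ x ∈ xs ] ∑[ a ∈ T ] ∑[ y ∈ xs ] ∑[ b ∈ T ] E (u ∷ s) (x ∷ a) (y ∷ b)
    ≡⟨ ∑-cong xs (λ {x} _ → ∑-cong T λ {a} _ → ∑-cong xs λ {y} _ → ∑-cong T λ {b} _ →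
         ⟦∧⟧ (does (ℤ.+ u ℤ.≟ ℤ.+ y ℤ.- ℤ.+ x)) (does (≡-dec ℤ._≟_ (map ℤ.+_ s) (diff b a)))) ⟩
  ∑[ x ∈ xs ] ∑[ a ∈ T ] ∑[ y ∈ xs ] ∑[ b ∈ T ] (𝟙 (ℤ.+ u ℤ.≟ ℤ.+ y ℤ.- ℤ.+ x) * E s a b)
    ≡⟨ ∑-*-∑ xs T (λ x y → 𝟙 (ℤ.+ u ℤ.≟ ℤ.+ y ℤ.- ℤ.+ x)) (E s) ⟩
  differenceCount xs u * pairCount xs m s
    ≡⟨ cong (differenceCount xs u *_) (pairCount≡product xs s) ⟩
  differenceCount xs u * product (map (differenceCount xs) s) ∎
  where
  open ≡-Reasoning
  m = length s
  T = tuples m xs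
  E : List ℕ → List ℕ → List ℕ → ℕ
  E s a b = 𝟙 (≡-dec ℤ._≟_ (map ℤ.+_ s) (diff b a))

product-map-mono-≤ : ∀ {f g : X → ℕ} xs → (∀ x → f x ≤ g x) → product (map f xs) ≤ product (map g xs)
product-map-mono-≤ []       f≤g = ≤-refl
product-map-mono-≤ (x ∷ xs) f≤g = *-mono-≤ (f≤g x) (product-map-mono-≤ xs f≤g)

product-map-≤-^ : ∀ {f : X → ℕ} {c} xs → (∀ x → f x ≤ c) → product (map f xs) ≤ c ^ length xs
product-map-≤-^ []       f≤c = ≤-refl
product-map-≤-^ (x ∷ xs) f≤c = *-mono-≤ (f≤c x) (product-map-≤-^ xs f≤c)

-- Weierstrass' product inequality ∏ (1 - xᵢ/N) ≥ 1 - ∑ xᵢ/N, cleared of denominators.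
weierstrass : ∀ N xs → N ^ suc (length xs) ≤ N * product (map (N ∸_) xs) + N ^ length xs * sum xs
weierstrass N []       = m≤m+n (N * 1) 0
weierstrass N (x ∷ xs) with x ≤? N
... | no  x≰N = begin
  N * N ^ suc m             ≡⟨ *-comm N _ ⟩
  N ^ suc m * N             ≤⟨ *-monoʳ-≤ (N ^ suc m) (≤-trans (<⇒≤ (≰⇒> x≰N)) (m≤m+n x (sum xs))) ⟩
  N ^ suc m * (x + sum xs)  ≤⟨ m≤n+m _ _ ⟩
  N * ((N ∸ x) * P) + N ^ suc m * (x + sum xs) ∎
  where
  open ≤-Reasoning
  m = length xs
  P = product (map (N ∸_) xs)
... | yes x≤N = induction-step (sym (m∸n+n≡m x≤N)) (weierstrass N xs)
  where
  open ≤-Reasoning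
  induction-step : ∀ {N d x a P σ} → N ≡ d + x → N * a ≤ N * P + a * σ →
         N * (N * a) ≤ N * (d * P) + N * a * (x + σ)
  induction-step {d = d} {x} {a} {P} {σ} refl ih = begin
    (d + x) * ((d + x) * a)                             ≡⟨ solve (d ∷ x ∷ a ∷ []) ⟩
    d * ((d + x) * a) + (d + x) * a * x                 ≤⟨ +-mono-≤ (*-monoʳ-≤ d ih) (m≤n+m _ (x * a * σ)) ⟩
    d * ((d + x) * P + a * σ) + (x * a * σ + (d + x) * a * x)
      ≡⟨ solve (d ∷ x ∷ a ∷ P ∷ σ ∷ []) ⟩
    (d + x) * (d * P) + (d + x) * a * (x + σ)           ∎

N*a≤N*P+a*σ⇒a≤2*P : ∀ {N a P σ} → 1 ≤ N → N * a ≤ N * P + a * σ → 2 * σ ≤ N → a ≤ 2 * P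
N*a≤N*P+a*σ⇒a≤2*P {N} {a} {P} {σ} 1≤N Na≤NP+aσ 2σ≤N =
  *-cancelˡ-≤ N {{>-nonZero 1≤N}} (+-cancelʳ-≤ (N * a) _ _ (begin
  N * a + N * a                  ≡⟨ solve (N ∷ a ∷ []) ⟩
  2 * (N * a)                    ≤⟨ *-monoʳ-≤ 2 Na≤NP+aσ ⟩
  2 * (N * P + a * σ)            ≡⟨ solve (N ∷ a ∷ P ∷ σ ∷ []) ⟩
  N * (2 * P) + a * (2 * σ)      ≤⟨ +-monoʳ-≤ (N * (2 * P)) (*-monoʳ-≤ a 2σ≤N) ⟩
  N * (2 * P) + a * N            ≡⟨ cong (N * (2 * P) +_) (*-comm a N) ⟩
  N * (2 * P) + N * a            ∎))
  where open ≤-Reasoning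

^-length≤2*product-∸ : ∀ {N} xs → 1 ≤ N → 2 * sum xs ≤ N → N ^ length xs ≤ 2 * product (map (N ∸_) xs)
^-length≤2*product-∸ {N} xs 1≤N = N*a≤N*P+a*σ⇒a≤2*P 1≤N (weierstrass N xs)

-- The vectors v[j₁, …, j_t]

length-block : ∀ k j val → length (block k j val) ≡ k
length-block k j val = trans (length-map _ (range k)) (length-range k)

length-vAux : ∀ k pre js → length (vAux k pre js) ≡ length js * k
length-vAux k pre []       = refl
length-vAux k pre (j ∷ js) = trans (length-++ (block k j (angle k pre)))
  (cong₂ _+_ (length-block k j _) (length-vAux k (pre ++ [ j ]) js))

block-injective : ∀ {k j j′ val} → 1 ≤ val → j ∈ range k → block k j val ≡ block k j′ val → j ≡ j′
-- does (m ≟ n) reduces to m ≡ᵇ n, the test used in block.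
block-injective {j = j} {j′} {val} 1≤val j∈ eq with j ≟ j′
... | yes j≡j′ = j≡j′
... | no  j≢j′ = contradiction (subst (1 ≤_) val≡0 1≤val) λ ()
  where
  open ≡-Reasoning
  val≡0 : val ≡ 0
  val≡0 = begin
    val                          ≡⟨ cong (λ b → if b then val else 0) (dec-true (j ≟ j) refl) ⟨
    (if j ≡ᵇ j then val else 0)  ≡⟨ map-≡⇒≡ eq j∈ ⟩
    (if j ≡ᵇ j′ then val else 0) ≡⟨ cong (λ b → if b then val else 0) (dec-false (j ≟ j′) j≢j′) ⟩
    0                            ∎

vAux-injective : ∀ k pre {js js′} → All (_∈ range k) js → length js ≡ length js′ →
                 vAux k pre js ≡ vAux k pre js′ → js ≡ js′
vAux-injective k pre {[]}     {[]}       _                 _     _  = refl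
vAux-injective k pre {j ∷ js} {j′ ∷ js′} (j∈ All.∷ js⊆) |js| eq
  with blocks≡ , rest≡ ← ++-injective (block k j _) (block k j′ _)
                           (trans (length-block k j _) (sym (length-block k j′ _))) eq
  with refl ← block-injective (s≤s z≤n) j∈ blocks≡
  = cong (j ∷_) (vAux-injective k (pre ++ [ j ]) js⊆ (suc-injective |js|) rest≡)

sum-block : ∀ k j val → sum (block k j val) ≤ val
sum-block k j val = begin
  ∑[ q ∈ range k ] (if q ≡ᵇ j then val else 0) ≤⟨ ∑-mono-≤ (range k) (λ {q} _ → entry≤ q) ⟩
  ∑[ q ∈ range k ] (val * 𝟙 (q ≟ j))                 ≡⟨ ∑-*ˡ (range k) val _ ⟩
  val * ∑[ q ∈ range k ] 𝟙 (q ≟ j)                   ≤⟨ *-monoʳ-≤ val (∑-𝟙≟-unique _≟_ (Unique-range k) j) ⟩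
  val * 1                                             ≡⟨ *-identityʳ val ⟩
  val                                                 ∎
  where
  open ≤-Reasoning
  entry≤ : ∀ q → (if q ≡ᵇ j then val else 0) ≤ val * 𝟙 (q ≟ j)
  entry≤ q with q ≡ᵇ j
  ... | true  = ≤-reflexive (sym (*-identityʳ val))
  ... | false = z≤n

digit< : ∀ {k j} acc → j ∈ range k → suc (acc * k + (j ∸ 1)) ≤ suc acc * k
digit< {k} {j} acc j∈ with 1≤j , j≤k ← ∈-range⁻ j∈ = begin
  suc (acc * k + (j ∸ 1)) ≡⟨ +-suc (acc * k) (j ∸ 1) ⟨
  acc * k + suc (j ∸ 1)   ≡⟨ cong (acc * k +_) (trans (+-comm 1 (j ∸ 1)) (m∸n+n≡m 1≤j)) ⟩
  acc * k + j             ≤⟨ +-monoʳ-≤ (acc * k) j≤k ⟩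
  acc * k + k             ≡⟨ +-comm (acc * k) k ⟩
  suc acc * k             ∎
  where open ≤-Reasoning

foldl-digits< : ∀ k acc js → All (_∈ range k) js →
  suc (foldl (λ acc j → acc * k + (j ∸ 1)) acc js) ≤ suc acc * k ^ length js
foldl-digits< k acc []       All.[]          = ≤-reflexive (sym (*-identityʳ (suc acc)))
foldl-digits< k acc (j ∷ js) (j∈ All.∷ js⊆) = begin
  suc (foldl _ (acc * k + (j ∸ 1)) js)   ≤⟨ foldl-digits< k (acc * k + (j ∸ 1)) js js⊆ ⟩
  suc (acc * k + (j ∸ 1)) * k ^ length js ≤⟨ *-monoˡ-≤ (k ^ length js) (digit< acc j∈) ⟩
  suc acc * k * k ^ length js             ≡⟨ *-assoc (suc acc) k _ ⟩
  suc acc * k ^ suc (length js)           ∎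
  where
  open ≤-Reasoning

angle≤ : ∀ k {js} → All (_∈ range k) js → angle k js ≤ k ^ length js
angle≤ k {js} js⊆ = ≤-trans (foldl-digits< k 0 js js⊆) (≤-reflexive (+-identityʳ _))

sum-vAux : ∀ k M pre js → All (_∈ range k) pre → All (_∈ range k) js →
           length pre + length js ≤ suc M → sum (vAux k pre js) ≤ length js * k ^ M
sum-vAux k M pre []       _    _               _   = z≤n
sum-vAux k M pre (j ∷ js) pre⊆ (j∈ All.∷ js⊆) |pre|+|js|≤ = begin
  sum (block k j (angle k pre) ++ vAux k (pre ++ [ j ]) js)
    ≡⟨ sum-++ (block k j (angle k pre)) _ ⟩
  sum (block k j (angle k pre)) + sum (vAux k (pre ++ [ j ]) js)
    ≤⟨ +-mono-≤ (≤-trans (sum-block k j _) angle≤k^M)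
                (sum-vAux k M (pre ++ [ j ]) js (All.++⁺ pre⊆ (j∈ All.∷ All.[])) js⊆ |pre++j|+|js|≤) ⟩
  k ^ M + length js * k ^ M ∎
  where
  open ≤-Reasoning
  instance
    k≢0 : NonZero k
    k≢0 = >-nonZero (≤-trans (proj₁ (∈-range⁻ j∈)) (proj₂ (∈-range⁻ j∈)))
  |pre++j|+|js|≤ : length (pre ++ [ j ]) + length js ≤ suc M
  |pre++j|+|js|≤ = subst (_≤ suc M)
    (trans (sym (+-assoc (length pre) 1 (length js))) (cong (_+ length js) (sym (length-++ pre))))
    |pre|+|js|≤
  angle≤k^M : angle k pre ≤ k ^ M
  angle≤k^M = ≤-trans (angle≤ k pre⊆)
    (^-monoʳ-≤ k (s≤s⁻¹ (≤-trans (s≤s (m≤m+n (length pre) (length js)))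
                                  (subst (_≤ suc M) (+-suc (length pre) (length js)) |pre|+|js|≤))))

sum-v : ∀ k M {js} → All (_∈ range k) js → length js ≡ suc M → sum (v k js) ≤ suc M * k ^ M
sum-v k M {js} js⊆ |js| =
  subst (λ n → sum (v k js) ≤ n * k ^ M) |js| (sum-vAux k M [] js All.[] js⊆ (≤-reflexive |js|))

length-v : ∀ t k {js} → js ∈ tuples t (range k) → length (v k js) ≡ t * k
length-v t k {js} js∈ = trans (length-vAux k [] js) (cong (_* k) (proj₁ (∈-tuples⁻ t (range k) js∈)))

-- The number of ones of A_t

Unique-𝓢 : ∀ t k → Unique (𝓢 t k)
Unique-𝓢 t k = Unique-map⁺ v-injective (Unique-tuples t (Unique-range k))
  where
  v-injective : ∀ {js js′} → js ∈ tuples t (range k) → js′ ∈ tuples t (range k) → v k js ≡ v k js′ → js ≡ js′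
  v-injective js∈ js′∈ with |js| , js⊆ ← ∈-tuples⁻ t (range k) js∈ | |js′| , _ ← ∈-tuples⁻ t (range k) js′∈ =
    vAux-injective k [] js⊆ (trans |js| (sym |js′|))

A≡∑ : ∀ t k a b →
  A t k a b ≡ ∑[ js ∈ tuples t (range k) ] 𝟙 (≡-dec ℤ._≟_ (map ℤ.+_ (v k js)) (diff b a))
A≡∑ t k a b = begin
  ⟦ any (does ∘ match) (𝓢 t k) ⟧ ≡⟨ ⟦any⟧ (does ∘ match) (𝓢 t k) at-most-one ⟩
  ∑[ s ∈ 𝓢 t k ] 𝟙 (match s)      ≡⟨ ∑-map (v k) (tuples t (range k)) (𝟙 ∘ match) ⟩
  ∑[ js ∈ tuples t (range k) ] 𝟙 (match (v k js)) ∎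
  where
  open ≡-Reasoning
  match : ∀ s → Dec (map ℤ.+_ s ≡ diff b a)
  match s = ≡-dec ℤ._≟_ (map ℤ.+_ s) (diff b a)
  at-most-one : ∑[ s ∈ 𝓢 t k ] 𝟙 (match s) ≤ 1
  at-most-one = subst (_≤ 1) (∑-map (map (λ n → ℤ.+ n)) (𝓢 t k) (λ s → 𝟙 (≡-dec ℤ._≟_ s (diff b a))))
    (∑-𝟙≟-unique (≡-dec ℤ._≟_) (Unique.map⁺ (map-injective ℤ.+-injective) (Unique-𝓢 t k)) (diff b a))

norm1≡∑product : ∀ t k →
  norm1 t k ≡ ∑[ js ∈ tuples t (range k) ] product (map (differenceCount (range (k ^ t))) (v k js))
norm1≡∑product t k = begin
  ∑[ a ∈ I ] ∑[ b ∈ I ] A t k a b           ≡⟨ ∑-cong I (λ {a} _ → ∑-cong I λ {b} _ → A≡∑ t k a b) ⟩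
  ∑[ a ∈ I ] ∑[ b ∈ I ] ∑[ js ∈ J ] E js a b ≡⟨ ∑-cong I (λ {a} _ → ∑-comm I J (λ b js → E js a b)) ⟩
  ∑[ a ∈ I ] ∑[ js ∈ J ] ∑[ b ∈ I ] E js a b ≡⟨ ∑-comm I J _ ⟩
  ∑[ js ∈ J ] pairCount N (t * k) (v k js)   ≡⟨ ∑-cong J pairCount-v ⟩
  ∑[ js ∈ J ] product (map (differenceCount N) (v k js)) ∎
  where
  open ≡-Reasoning
  I = 𝓘 t k
  J = tuples t (range k)
  N = range (k ^ t)
  E : List ℕ → List ℕ → List ℕ → ℕ
  E js a b = 𝟙 (≡-dec ℤ._≟_ (map ℤ.+_ (v k js)) (diff b a))
  pairCount-v : ∀ {js} → js ∈ J → pairCount N (t * k) (v k js) ≡ product (map (differenceCount N) (v k js))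
  pairCount-v {js} js∈ = subst (λ m → pairCount N m (v k js) ≡ product (map (differenceCount N) (v k js)))
    (length-v t k js∈) (pairCount≡product N (v k js))

length-tuples-range : ∀ t k → length (tuples t (range k)) ≡ k ^ t
length-tuples-range t k = trans (length-tuples t (range k)) (cong (_^ t) (length-range k))

norm1≤k^t*size : ∀ t k → norm1 t k ≤ k ^ t * size t k
norm1≤k^t*size t k = begin
  norm1 t k                                   ≡⟨ norm1≡∑product t k ⟩
  ∑[ js ∈ J ] product (map (differenceCount (range N)) (v k js))
    ≤⟨ ∑-mono-≤ J (λ {js} js∈ → ≤-trans (product-map-≤-^ (v k js) (differenceCount≤ N))
                                          (≤-reflexive (cong (N ^_) (length-v t k js∈)))) ⟩
  ∑[ js ∈ J ] size t k                        ≡⟨ ∑-const J (size t k) ⟩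
  length J * size t k                         ≡⟨ cong (_* size t k) (length-tuples-range t k) ⟩
  k ^ t * size t k                            ∎
  where
  open ≤-Reasoning
  J = tuples t (range k)
  N = k ^ t

k^t*size≤2*norm1 : ∀ t k → 1 ≤ t → 2 * t ≤ k → k ^ t * size t k ≤ 2 * norm1 t k
k^t*size≤2*norm1 t@(suc M) k _ 2t≤k = begin
  k ^ t * size t k                            ≡⟨ cong (_* size t k) (length-tuples-range t k) ⟨
  length J * size t k                         ≡⟨ ∑-const J (size t k) ⟨
  ∑[ js ∈ J ] size t k                        ≤⟨ ∑-mono-≤ J size≤ ⟩
  ∑[ js ∈ J ] (2 * product (map (differenceCount (range N)) (v k js)))
    ≡⟨ ∑-*ˡ J 2 _ ⟩
  2 * ∑[ js ∈ J ] product (map (differenceCount (range N)) (v k js))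
    ≡⟨ cong (2 *_) (norm1≡∑product t k) ⟨
  2 * norm1 t k                               ∎
  where
  open ≤-Reasoning
  J = tuples t (range k)
  N = k ^ t
  1≤N : 1 ≤ N
  1≤N = m^n>0 k {{>-nonZero (≤-trans (s≤s z≤n) 2t≤k)}} t
  size≤ : ∀ {js} → js ∈ J → size t k ≤ 2 * product (map (differenceCount (range N)) (v k js))
  size≤ {js} js∈ with |js| , js⊆ ← ∈-tuples⁻ t (range k) js∈ = begin
    size t k
      ≡⟨ cong (N ^_) (length-v t k js∈) ⟨
    N ^ length (v k js)
      ≤⟨ ^-length≤2*product-∸ (v k js) 1≤N (≤-trans (*-monoʳ-≤ 2 (sum-v k M js⊆ |js|)) 2t*k^M≤N) ⟩
    2 * product (map (N ∸_) (v k js))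
      ≤⟨ *-monoʳ-≤ 2 (product-map-mono-≤ (v k js) (∸≤differenceCount N)) ⟩
    2 * product (map (differenceCount (range N)) (v k js)) ∎
    where
    2t*k^M≤N : 2 * (t * k ^ M) ≤ N
    2t*k^M≤N = subst (_≤ N) (*-assoc 2 t (k ^ M)) (*-monoˡ-≤ (k ^ M) 2t≤k)

-- Logarithms

n<2^n : ∀ n → n < 2 ^ n
n<2^n zero    = s≤s z≤n
n<2^n (suc n) = +-mono-≤ (m^n>0 2 n) (≤-trans (n<2^n n) (m≤m+n _ 0))

1+n≤2*n : ∀ {n} → 1 ≤ n → suc n ≤ 2 * n
1+n≤2*n {n} 1≤n = +-mono-≤ 1≤n (m≤m+n n 0)

2*n≤2^n : ∀ n → 2 * n ≤ 2 ^ n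
2*n≤2^n zero    = z≤n
2*n≤2^n (suc n) = *-monoʳ-≤ 2 (n<2^n n)

^-distribʳ-* : ∀ m n o → (m * n) ^ o ≡ m ^ o * n ^ o
^-distribʳ-* m n zero    = refl
^-distribʳ-* m n (suc o) = trans (cong (m * n *_) (^-distribʳ-* m n o)) (*-interchange m n (m ^ o) (n ^ o))

2^m≤n⇒m≤⌊log₂n⌋ : ∀ {m n} → 2 ^ m ≤ n → m ≤ ⌊log₂ n ⌋
2^m≤n⇒m≤⌊log₂n⌋ {m} le = subst (_≤ _) (⌊log₂[2^n]⌋≡n m) (⌊log₂⌋-mono-≤ le)

n≤2^m⇒⌊log₂n⌋≤m : ∀ {m n} → n ≤ 2 ^ m → ⌊log₂ n ⌋ ≤ m
n≤2^m⇒⌊log₂n⌋≤m {m} le = subst (_ ≤_) (⌊log₂[2^n]⌋≡n m) (⌊log₂⌋-mono-≤ le)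

∃2^ℓ≤k<2^[1+ℓ] : ∀ k → 1 ≤ k → ∃[ ℓ ] 2 ^ ℓ ≤ k × k < 2 ^ suc ℓ
∃2^ℓ≤k<2^[1+ℓ] (suc zero)    _ = 0 , ≤-refl , s≤s (s≤s z≤n)
∃2^ℓ≤k<2^[1+ℓ] (suc (suc k)) _ with ∃2^ℓ≤k<2^[1+ℓ] (suc k) (s≤s z≤n)
... | ℓ , 2^ℓ≤ , <2^[1+ℓ] with suc (suc k) <? 2 ^ suc ℓ
...   | yes k+2<2^[1+ℓ] = ℓ , m≤n⇒m≤1+n 2^ℓ≤ , k+2<2^[1+ℓ]
...   | no  k+2≮2^[1+ℓ] = suc ℓ , ≤-reflexive (sym k+2≡2^[1+ℓ]) ,
          subst (_< 2 ^ suc (suc ℓ)) (sym k+2≡2^[1+ℓ]) (^-monoʳ-< 2 (s≤s (s≤s z≤n)) (n<1+n (suc ℓ)))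
  where
  k+2≡2^[1+ℓ] : suc (suc k) ≡ 2 ^ suc ℓ
  k+2≡2^[1+ℓ] = ≤-antisym <2^[1+ℓ] (≮⇒≥ k+2≮2^[1+ℓ])

size≡k^[t*[t*k]] : ∀ t k → size t k ≡ k ^ (t * (t * k))
size≡k^[t*[t*k]] t k = ^-*-assoc k t (t * k)

log-size-≥ : ∀ t ℓ {k} → 2 ^ ℓ ≤ k → ℓ * (t * (t * k)) ≤ ⌊log₂ size t k ⌋
log-size-≥ t ℓ {k} 2^ℓ≤k = 2^m≤n⇒m≤⌊log₂n⌋ (begin
  2 ^ (ℓ * T) ≡⟨ ^-*-assoc 2 ℓ T ⟨
  (2 ^ ℓ) ^ T ≤⟨ ^-monoˡ-≤ T 2^ℓ≤k ⟩
  k ^ T       ≡⟨ size≡k^[t*[t*k]] t k ⟨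
  size t k    ∎)
  where
  open ≤-Reasoning
  T = t * (t * k)

log-size-≤ : ∀ t ℓ {k} → k ≤ 2 ^ ℓ → ⌊log₂ size t k ⌋ ≤ ℓ * (t * (t * k))
log-size-≤ t ℓ {k} k≤2^ℓ = n≤2^m⇒⌊log₂n⌋≤m (begin
  size t k    ≡⟨ size≡k^[t*[t*k]] t k ⟩
  k ^ T       ≤⟨ ^-monoˡ-≤ T k≤2^ℓ ⟩
  (2 ^ ℓ) ^ T ≡⟨ ^-*-assoc 2 ℓ T ⟩
  2 ^ (ℓ * T) ∎)
  where
  open ≤-Reasoning
  T = t * (t * k)

k≤t*[t*k] : ∀ {t} k → 1 ≤ t → k ≤ t * (t * k)
k≤t*[t*k] {t} k 1≤t = ≤-trans (m≤n*m k t) (m≤n*m (t * k) t)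
  where instance _ = >-nonZero 1≤t

log-log-size-bounds : ∀ {t k ℓ} → 1 ≤ t → t ≤ ℓ → 2 ^ ℓ ≤ k → k < 2 ^ suc ℓ →
  ℓ ≤ ⌊log₂ ⌊log₂ size t k ⌋ ⌋ × ⌊log₂ ⌊log₂ size t k ⌋ ⌋ ≤ 8 * ℓ
log-log-size-bounds {t} {k} {ℓ} 1≤t t≤ℓ 2^ℓ≤k k<2^[1+ℓ] = ℓ≤LL , LL≤8*ℓ
  where
  open ≤-Reasoning
  1+ℓ≤k : suc ℓ ≤ k
  1+ℓ≤k = ≤-trans (n<2^n ℓ) 2^ℓ≤k
  t≤k : t ≤ k
  t≤k = ≤-trans t≤ℓ (≤-trans (n≤1+n ℓ) 1+ℓ≤k)
  ℓ≤LL : ℓ ≤ ⌊log₂ ⌊log₂ size t k ⌋ ⌋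
  ℓ≤LL = 2^m≤n⇒m≤⌊log₂n⌋ (begin
    2 ^ ℓ                 ≤⟨ 2^ℓ≤k ⟩
    k                     ≤⟨ k≤t*[t*k] k 1≤t ⟩
    t * (t * k)           ≤⟨ m≤n*m _ ℓ {{>-nonZero (≤-trans 1≤t t≤ℓ)}} ⟩
    ℓ * (t * (t * k))     ≤⟨ log-size-≥ t ℓ 2^ℓ≤k ⟩
    ⌊log₂ size t k ⌋      ∎)
  LL≤8*ℓ : ⌊log₂ ⌊log₂ size t k ⌋ ⌋ ≤ 8 * ℓ
  LL≤8*ℓ = n≤2^m⇒⌊log₂n⌋≤m (begin
    ⌊log₂ size t k ⌋       ≤⟨ log-size-≤ t (suc ℓ) (<⇒≤ k<2^[1+ℓ]) ⟩
    suc ℓ * (t * (t * k))  ≤⟨ *-mono-≤ 1+ℓ≤k (*-mono-≤ t≤k (*-monoˡ-≤ k t≤k)) ⟩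
    k * (k * (k * k))      ≡⟨ cong (λ x → k * (k * (k * x))) (*-identityʳ k) ⟨
    k ^ 4                  ≤⟨ ^-monoˡ-≤ 4 (<⇒≤ k<2^[1+ℓ]) ⟩
    (2 ^ suc ℓ) ^ 4        ≡⟨ ^-*-assoc 2 (suc ℓ) 4 ⟩
    2 ^ (suc ℓ * 4)        ≤⟨ ^-monoʳ-≤ 2 (*-monoˡ-≤ 4 (1+n≤2*n (≤-trans 1≤t t≤ℓ))) ⟩
    2 ^ (2 * ℓ * 4)        ≡⟨ cong (2 ^_) (trans (*-comm (2 * ℓ) 4) (sym (*-assoc 4 2 ℓ))) ⟩
    2 ^ (8 * ℓ)            ∎)

log-size-bounds : ∀ t k → 1 ≤ t → 2 ^ t ≤ k →
  ⌊log₂ size t k ⌋ ≤ 2 * (t * t) * (k * ⌊log₂ ⌊log₂ size t k ⌋ ⌋)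
  × k * ⌊log₂ ⌊log₂ size t k ⌋ ⌋ ≤ 8 * ⌊log₂ size t k ⌋
log-size-bounds t k 1≤t 2^t≤k
  with ℓ , 2^ℓ≤k , k<2^[1+ℓ] ← ∃2^ℓ≤k<2^[1+ℓ] k (≤-trans (m^n>0 2 t) 2^t≤k) = L≤ , kLL≤
  where
  open ≤-Reasoning
  L = ⌊log₂ size t k ⌋
  LL = ⌊log₂ L ⌋
  t≤ℓ : t ≤ ℓ
  t≤ℓ = ≮⇒≥ λ ℓ<t → <-irrefl refl (<-≤-trans k<2^[1+ℓ] (≤-trans (^-monoʳ-≤ 2 ℓ<t) 2^t≤k))
  LL-bounds : ℓ ≤ LL × LL ≤ 8 * ℓ
  LL-bounds = log-log-size-bounds 1≤t t≤ℓ 2^ℓ≤k k<2^[1+ℓ]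
  L≤ : L ≤ 2 * (t * t) * (k * LL)
  L≤ = begin
    L                       ≤⟨ log-size-≤ t (suc ℓ) (<⇒≤ k<2^[1+ℓ]) ⟩
    suc ℓ * (t * (t * k))   ≤⟨ *-monoˡ-≤ _ (≤-trans (1+n≤2*n (≤-trans 1≤t t≤ℓ)) (*-monoʳ-≤ 2 (proj₁ LL-bounds))) ⟩
    2 * LL * (t * (t * k))  ≡⟨ rearrange LL t k ⟩
    2 * (t * t) * (k * LL)  ∎
    where
    rearrange : ∀ a t k → 2 * a * (t * (t * k)) ≡ 2 * (t * t) * (k * a)
    rearrange = solve-∀
  kLL≤ : k * LL ≤ 8 * L
  kLL≤ = begin
    k * LL                  ≤⟨ *-monoʳ-≤ k (proj₂ LL-bounds) ⟩
    k * (8 * ℓ)             ≡⟨ solve (k ∷ ℓ ∷ []) ⟩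
    8 * (ℓ * k)             ≤⟨ *-monoʳ-≤ 8 (*-monoʳ-≤ ℓ (k≤t*[t*k] k 1≤t)) ⟩
    8 * (ℓ * (t * (t * k))) ≤⟨ *-monoʳ-≤ 8 (log-size-≥ t ℓ 2^ℓ≤k) ⟩
    8 * L                   ∎

Θ-lower : ∀ {n m K L LL c} t → K ^ t * n ≤ 2 * m → L ≤ c * (K * LL) → n * L ^ t ≤ 2 * c ^ t * (m * LL ^ t)
Θ-lower {n} {m} {K} {L} {LL} {c} t K^t*n≤2*m L≤ = begin
  n * L ^ t                        ≤⟨ *-monoʳ-≤ n (^-monoˡ-≤ t L≤) ⟩
  n * (c * (K * LL)) ^ t           ≡⟨ cong (n *_) (trans (^-distribʳ-* c _ t) (cong (c ^ t *_) (^-distribʳ-* K LL t))) ⟩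
  n * (c ^ t * (K ^ t * LL ^ t))   ≡⟨ shuffle n (c ^ t) (K ^ t) (LL ^ t) ⟩
  c ^ t * (K ^ t * n * LL ^ t)     ≤⟨ *-monoʳ-≤ (c ^ t) (*-monoˡ-≤ (LL ^ t) K^t*n≤2*m) ⟩
  c ^ t * (2 * m * LL ^ t)         ≡⟨ shuffle′ (c ^ t) m (LL ^ t) ⟩
  2 * c ^ t * (m * LL ^ t)         ∎
  where
  open ≤-Reasoning
  shuffle : ∀ a b c d → a * (b * (c * d)) ≡ b * (c * a * d)
  shuffle = solve-∀
  shuffle′ : ∀ a b c → a * (2 * b * c) ≡ 2 * a * (b * c)
  shuffle′ = solve-∀

Θ-upper : ∀ {n m K L LL C} t → m ≤ K ^ t * n → K * LL ≤ C * L → m * LL ^ t ≤ C ^ t * (n * L ^ t)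
Θ-upper {n} {m} {K} {L} {LL} {C} t m≤K^t*n K*LL≤ = begin
  m * LL ^ t               ≤⟨ *-monoˡ-≤ (LL ^ t) m≤K^t*n ⟩
  K ^ t * n * LL ^ t       ≡⟨ shuffle (K ^ t) n (LL ^ t) ⟩
  n * (K ^ t * LL ^ t)     ≡⟨ cong (n *_) (^-distribʳ-* K LL t) ⟨
  n * (K * LL) ^ t         ≤⟨ *-monoʳ-≤ n (^-monoˡ-≤ t K*LL≤) ⟩
  n * (C * L) ^ t          ≡⟨ cong (n *_) (^-distribʳ-* C L t) ⟩
  n * (C ^ t * L ^ t)      ≡⟨ shuffle′ n (C ^ t) (L ^ t) ⟩
  C ^ t * (n * L ^ t)      ∎
  where
  open ≤-Reasoning
  shuffle : ∀ a b c → a * b * c ≡ b * (a * c)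
  shuffle = solve-∀
  shuffle′ : ∀ a b c → a * (b * c) ≡ b * (a * c)
  shuffle′ = solve-∀

lemma2 : (t : ℕ) → 2 ≤ t →
    Σ ℕ λ c → Σ ℕ λ C → Σ ℕ λ k₀ → (k : ℕ) → k₀ ≤ k →
      (size t k * ⌊log₂ size t k ⌋ ^ t ≤ c * (norm1 t k * ⌊log₂ ⌊log₂ size t k ⌋ ⌋ ^ t))
      × (norm1 t k * ⌊log₂ ⌊log₂ size t k ⌋ ⌋ ^ t ≤ C * (size t k * ⌊log₂ size t k ⌋ ^ t))
lemma2 t 2≤t = 2 * (2 * (t * t)) ^ t , 8 ^ t , 2 ^ t , λ k 2^t≤k →
  let L≤ , k*LL≤ = log-size-bounds t k 1≤t 2^t≤k
  in Θ-lower {m = norm1 t k} t (k^t*size≤2*norm1 t k 1≤t (≤-trans (2*n≤2^n t) 2^t≤k)) L≤ ,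
     Θ-upper {m = norm1 t k} t (norm1≤k^t*size t k) k*LL≤
  where
  1≤t : 1 ≤ t
  1≤t = ≤-trans (s≤s z≤n) 2≤t
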